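{- Let $n,k,f$ be integers with $k\ge1$, $f\ge0$ and $2k+f\le n$. Let $\Pi_{n,k,f}(134/2)$ be the set of set partitions of $[n]$ avoiding $134/2$ that have exactly $k+f$ blocks, exactly $f$ of which are singletons. Let $C_{N,k}$ be the set of weak compositions of $N$ into $k$ parts (sequences of $k$ nonnegative integers summing to $N$), and let $M_{k,f}$ be the set of set partitions of $[2k+f]$ with exactly $f$ singleton blocks and $k$ blocks of size two. Then there is a bijection $\Pi_{n,k,f}(134/2)\to C_{n-f-2k,k}\times M_{k,f}$.
   Context: The standardization of a set partition of a finite set $S\subset\mathbb{Z}_{>0}$ replaces the $i$-th smallest element of $S$ by $i$. A set partition $\pi$ of $[n]$ contains $\tau\vdash[k]$ if for some $S\subseteq[n]$ the standardization of the restriction of $\pi$ to $S$ is $\tau$; otherwise it avoids $\tau$. $134/2$ is the partition of $[4]$ with blocks $\{1,3,4\},\{2\}$. -}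

module Defs where

open import Data.Nat using (ℕ; zero; suc; _+_; _∸_; _≤_; _<_; _⊔_)
open import Data.Fin using (Fin; toℕ)
open import Data.Vec using (Vec; []; _∷_; lookup; foldr; count; toList)
open import Data.Vec.Relation.Unary.All using (All)
open import Data.List using (List)
import Data.List as L
open import Data.Nat using (_≟_)
open import Data.Product using (Σ; ∃; _×_; _,_)
open import Relation.Binary.PropositionalEquality using (_≡_)
open import Relation.Nullary using (¬_)
open import Function.Bundles using (_↔_)

-- A set partition of [n] = {0,…,n-1} is encoded canonically by its
-- restricted growth string a : Vec ℕ n : a[i] is the index of the block
-- containing i, blocks being numbered 0,1,2,… in order of their least
-- elements.

-- validity checked from the left, carrying the number m of blocks seen so far
ValidFrom : ℕ → {n : ℕ} → Vec ℕ n → Set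
ValidFrom m [] = Data.Unit.⊤
  where import Data.Unit
ValidFrom m (x ∷ xs) = (x ≤ m) × ValidFrom (m ⊔ suc x) xs

IsRGS : {n : ℕ} → Vec ℕ n → Set
IsRGS a = ValidFrom 0 a

SetPartition : ℕ → Set
SetPartition n = Σ (Vec ℕ n) IsRGS

-- number of blocks (labels used are exactly 0,…,numBlocks-1)
numBlocks : {n : ℕ} → Vec ℕ n → ℕ
numBlocks a = foldr (λ _ → ℕ) (λ x r → suc x ⊔ r) 0 a

blockSize : {n : ℕ} → Vec ℕ n → ℕ → ℕ
blockSize a b = count (λ x → x ≟ b) a

numSingletons : {n : ℕ} → Vec ℕ n → ℕ
numSingletons a = L.length (L.filter (λ b → blockSize a b ≟ 1) (L.upTo (numBlocks a)))

numDoubletons : {n : ℕ} → Vec ℕ n → ℕ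
numDoubletons a = L.length (L.filter (λ b → blockSize a b ≟ 2) (L.upTo (numBlocks a)))

-- strictly increasing maps Fin k → Fin n (choice of a subset S of size k)
StrictlyIncreasing : {k n : ℕ} → (Fin k → Fin n) → Set
StrictlyIncreasing {k} ι = ∀ (i j : Fin k) → toℕ i < toℕ j → toℕ (ι i) < toℕ (ι j)

-- π contains τ: some k-subset S of [n] such that the standardization of
-- π restricted to S equals τ, i.e. two elements of S lie in the same
-- block of π iff their standardized positions lie in the same block of τ.
Contains : {n k : ℕ} → SetPartition n → SetPartition k → Set
Contains {n} {k} (a , _) (t , _) =
  Σ (Fin k → Fin n) λ ι → StrictlyIncreasing ι ×
    (∀ (i j : Fin k) → (lookup a (ι i) ≡ lookup a (ι j) → lookup t i ≡ lookup t j)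
                     × (lookup t i ≡ lookup t j → lookup a (ι i) ≡ lookup a (ι j)))

Avoids : {n k : ℕ} → SetPartition n → SetPartition k → Set
Avoids π τ = ¬ Contains π τ

-- the partition 134/2 of [4]: blocks {1,3,4},{2}; RGS 0 1 0 0
p134/2 : SetPartition 4
p134/2 = (0 ∷ 1 ∷ 0 ∷ 0 ∷ []) , (Data.Nat.z≤n , (Data.Nat.s≤s Data.Nat.z≤n , (Data.Nat.z≤n , (Data.Nat.z≤n , _))))
  where import Data.Nat

-- Π_{n,k,f}(134/2).  The property proofs are marked irrelevant so that
-- elements are determined by the underlying partition (¬ _ is not a
-- proposition up to ≡ without function extensionality).
record Pi (n k f : ℕ) : Set where
  constructor mkPi
  field
    partition : SetPartition n
    .avoids   : Avoids partition p134/2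
    .blocks   : numBlocks (Data.Product.proj₁ partition) ≡ k + f
    .singles  : numSingletons (Data.Product.proj₁ partition) ≡ f

sumV : {k : ℕ} → Vec ℕ k → ℕ
sumV = foldr (λ _ → ℕ) _+_ 0

WeakComposition : ℕ → ℕ → Set
WeakComposition N k = Σ (Vec ℕ k) λ c → sumV c ≡ N

M : ℕ → ℕ → Set
M k f = Σ (SetPartition (2 Data.Nat.* k + f)) λ π →
  (numSingletons (Data.Product.proj₁ π) ≡ f)
  × (numDoubletons (Data.Product.proj₁ π) ≡ k)
  × (numBlocks (Data.Product.proj₁ π) ≡ k + f)

-- A restricted growth string avoids 134/2 iff it has no subsequence x y x x with x ≢ y, that is,
-- iff in every block all elements except possibly the largest form a run of consecutive positions
-- starting at the least one. Keeping only the least and the largest element of every block then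
-- leaves a partition of [2k+f] into f singletons and k pairs, and the numbers of deleted elements,
-- one for each block of size at least two, form a weak composition of n − f − 2k into k parts.
-- Reinserting the deleted elements right after the least element of their block inverts this.

module Submission where

open import Defs
open import Data.Bool using (Bool; true; false; T)
open import Data.Bool.Properties using (T-≡)
open import Data.Fin using (Fin; toℕ; zero; suc)
open import Data.List using (List; []; _∷_; _++_; length; replicate; applyUpTo; filter; tabulate)
open import Data.List.Properties using (length-++; length-replicate; tabulate-cong)
open import Data.List.Relation.Binary.Sublist.Propositional using (_⊆_; []; _∷_; _∷ʳ_; ⊆-refl; ⊆-trans)
open import Data.List.Relation.Binary.Sublist.Propositional.Properties using ([]⊆-universal; ∷ˡ⁻; ++⁺ˡ)
open import Data.Nat
open import Data.Nat.Induction using (<-wellFounded)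
open import Data.Nat.ListAction using (sum)
open import Data.Nat.Properties
open import Algebra.Properties.CommutativeSemigroup +-commutativeSemigroup using (interchange; x∙yz≈y∙xz)
open import Data.Nat.Tactic.RingSolver using (solve-∀)
open import Data.Product using (Σ; ∃; ∃₂; _×_; _,_; proj₁; proj₂)
open import Data.Product.Properties using (Σ-≡,≡→≡)
open import Data.Sum using (_⊎_; inj₁; inj₂)
open import Data.Vec using (Vec; []; _∷_; fromList; toList; lookup; cast)
open import Data.Vec.Properties using (lookup-map; cast-is-id; toList-cast; toList∘fromList; fromList∘toList; length-toList)
open import Function using (_∘_; id)
open import Function.Bundles using (Equivalence; _↔_; mk↔ₛ′)
open import Induction.WellFounded using (Acc; acc)
open import Relation.Binary.PropositionalEquality
open import Relation.Nullary using (¬_; Dec; yes; no; does; contradiction)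
open import Relation.Nullary.Decidable using (recompute)
open import Relation.Nullary.Recomputable using (¬-recompute)

occ : List ℕ → ℕ → ℕ
occ l = blockSize (fromList l)

blocks : List ℕ → ℕ
blocks l = numBlocks (fromList l)

RGSFrom : ℕ → List ℕ → Set
RGSFrom m l = ValidFrom m (fromList l)

𝟙 : Bool → ℕ
𝟙 true = 1
𝟙 false = 0

≡ᵇ-true : ∀ {x m} → x ≡ m → (x ≡ᵇ m) ≡ true
≡ᵇ-true {x} {m} x≡m = Equivalence.to T-≡ (≡⇒≡ᵇ x m x≡m)

≡ᵇ-false : ∀ {x m} → x ≢ m → (x ≡ᵇ m) ≡ false
≡ᵇ-false {x} {m} x≢m with x ≡ᵇ m in x≡ᵇm
... | false = refl
... | true = contradiction (≡ᵇ⇒≡ x m (subst T (sym x≡ᵇm) _)) x≢m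

occ-∷ : ∀ x l b → occ (x ∷ l) b ≡ 𝟙 (x ≡ᵇ b) + occ l b
occ-∷ x l b with x ≡ᵇ b
... | true = refl
... | false = refl

occ-here : ∀ x l → occ (x ∷ l) x ≡ suc (occ l x)
occ-here x l = trans (occ-∷ x l x) (cong (λ t → 𝟙 t + occ l x) (≡ᵇ-true {x} refl))

occ-there : ∀ {x b} l → x ≢ b → occ (x ∷ l) b ≡ occ l b
occ-there {x} {b} l x≢b = trans (occ-∷ x l b) (cong (λ t → 𝟙 t + occ l b) (≡ᵇ-false x≢b))

occ-++ : ∀ l l′ b → occ (l ++ l′) b ≡ occ l b + occ l′ b
occ-++ [] l′ b = refl
occ-++ (x ∷ l) l′ b = begin
  occ (x ∷ l ++ l′) b                 ≡⟨ occ-∷ x (l ++ l′) b ⟩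
  𝟙 (x ≡ᵇ b) + occ (l ++ l′) b        ≡⟨ cong (𝟙 (x ≡ᵇ b) +_) (occ-++ l l′ b) ⟩
  𝟙 (x ≡ᵇ b) + (occ l b + occ l′ b)   ≡⟨ +-assoc (𝟙 (x ≡ᵇ b)) _ _ ⟨
  𝟙 (x ≡ᵇ b) + occ l b + occ l′ b     ≡⟨ cong (_+ occ l′ b) (occ-∷ x l b) ⟨
  occ (x ∷ l) b + occ l′ b            ∎
  where open ≡-Reasoning

occ-replicate : ∀ c x → occ (replicate c x) x ≡ c
occ-replicate zero x = refl
occ-replicate (suc c) x = trans (occ-here x (replicate c x)) (cong suc (occ-replicate c x))

occ-replicate-≢ : ∀ c {x b} → x ≢ b → occ (replicate c x) b ≡ 0
occ-replicate-≢ zero x≢b = refl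
occ-replicate-≢ (suc c) {x} x≢b = trans (occ-there (replicate c x) x≢b) (occ-replicate-≢ c x≢b)

occ-≤-∷ : ∀ x l b → occ l b ≤ occ (x ∷ l) b
occ-≤-∷ x l b with x ≡ᵇ b
... | true = n≤1+n _
... | false = ≤-refl

occ-≤-++ : ∀ pre l b → occ l b ≤ occ (pre ++ l) b
occ-≤-++ pre l b = subst (occ l b ≤_) (sym (occ-++ pre l b)) (m≤n+m (occ l b) (occ pre b))

⊆⇒occ-≤ : ∀ {xs ys} → xs ⊆ ys → ∀ b → occ xs b ≤ occ ys b
⊆⇒occ-≤ [] b = z≤n
⊆⇒occ-≤ (_∷ʳ_ {ys = ys} y p) b = ≤-trans (⊆⇒occ-≤ p b) (occ-≤-∷ y ys b)
⊆⇒occ-≤ (_∷_ {x} refl p) b with x ≡ᵇ b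
... | true = s≤s (⊆⇒occ-≤ p b)
... | false = ⊆⇒occ-≤ p b

replicate-⊆ : ∀ n x l → n ≤ occ l x → replicate n x ⊆ l
replicate-⊆ zero x l _ = []⊆-universal l
replicate-⊆ (suc n) x (y ∷ l) n<occ with y ≟ x
... | yes refl = refl ∷ replicate-⊆ n x l (s≤s⁻¹ (subst (suc n ≤_) (occ-here x l) n<occ))
... | no y≢x = y ∷ʳ replicate-⊆ (suc n) x l (subst (suc n ≤_) (occ-there l y≢x) n<occ)

∑< : ℕ → (ℕ → ℕ) → ℕ
∑< zero g = 0
∑< (suc d) g = g 0 + ∑< d (g ∘ suc)

∑<-cong : ∀ d {g h} → (∀ i → i < d → g i ≡ h i) → ∑< d g ≡ ∑< d h
∑<-cong zero g≡h = refl
∑<-cong (suc d) g≡h = cong₂ _+_ (g≡h 0 z<s) (∑<-cong d (λ i i<d → g≡h (suc i) (s<s i<d)))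

∑<-+ : ∀ d g h → ∑< d (λ i → g i + h i) ≡ ∑< d g + ∑< d h
∑<-+ zero g h = refl
∑<-+ (suc d) g h = trans (cong (g 0 + h 0 +_) (∑<-+ d (g ∘ suc) (h ∘ suc)))
                         (interchange (g 0) (h 0) (∑< d (g ∘ suc)) (∑< d (h ∘ suc)))

∑<-ones : ∀ d {g} → (∀ i → i < d → g i ≡ 1) → ∑< d g ≡ d
∑<-ones zero _ = refl
∑<-ones (suc d) g≡1 = cong₂ _+_ (g≡1 0 z<s) (∑<-ones d (λ i i<d → g≡1 (suc i) (s<s i<d)))

∑<-zeros : ∀ d → ∑< d (λ _ → 0) ≡ 0
∑<-zeros zero = refl
∑<-zeros (suc d) = ∑<-zeros d

∑<≡0⇒≡0 : ∀ d g → ∑< d g ≡ 0 → ∀ {i} → i < d → g i ≡ 0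
∑<≡0⇒≡0 (suc d) g ∑≡0 {zero} _ = m+n≡0⇒m≡0 (g 0) ∑≡0
∑<≡0⇒≡0 (suc d) g ∑≡0 {suc i} (s<s i<d) = ∑<≡0⇒≡0 d (g ∘ suc) (m+n≡0⇒n≡0 (g 0) ∑≡0) i<d

∑<-point : ∀ {x d} → x < d → ∑< d (λ i → 𝟙 (x ≡ᵇ i)) ≡ 1
∑<-point {zero} {suc d} _ = cong suc (∑<-zeros d)
∑<-point {suc x} {suc d} (s<s x<d) = ∑<-point x<d

length-filter-applyUpTo : ∀ {P : ℕ → Set} (P? : ∀ i → Dec (P i)) f d →
  length (filter P? (applyUpTo f d)) ≡ ∑< d (λ i → 𝟙 (does (P? (f i))))
length-filter-applyUpTo P? f zero = refl
length-filter-applyUpTo P? f (suc d) with does (P? (f 0))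
... | true = cong suc (length-filter-applyUpTo P? (f ∘ suc) d)
... | false = length-filter-applyUpTo P? (f ∘ suc) d

x<m⊔1+x : ∀ m x → x < m ⊔ suc x
x<m⊔1+x m x = m≤n⊔m m (suc x)

m⊔1+x≡m : ∀ {x m} → x < m → m ⊔ suc x ≡ m
m⊔1+x≡m = m≥n⇒m⊔n≡m

m⊔1+x≤b : ∀ {x m b} → x ≤ m → m ≤ b → x ≢ b → m ⊔ suc x ≤ b
m⊔1+x≤b x≤m m≤b x≢b = ⊔-lub m≤b (≤∧≢⇒< (≤-trans x≤m m≤b) x≢b)

<⊔1+⇒< : ∀ {x m b} → x ≤ m → b < m ⊔ suc x → b ≢ x → b < m
<⊔1+⇒< {x} {m} {b} x≤m b<m′ b≢x with ⊔-sel m (suc x)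
... | inj₁ m′≡m = subst (b <_) m′≡m b<m′
... | inj₂ m′≡1+x = <-≤-trans (≤∧≢⇒< (s≤s⁻¹ (subst (b <_) m′≡1+x b<m′)) b≢x) x≤m

occ-≥blocks : ∀ l {b} → blocks l ≤ b → occ l b ≡ 0
occ-≥blocks [] _ = refl
occ-≥blocks (x ∷ r) {b} blocks≤b =
  trans (occ-there r x≢b) (occ-≥blocks r (≤-trans (m≤n⊔m (suc x) (blocks r)) blocks≤b))
  where
  x≢b : x ≢ b
  x≢b x≡b = <-irrefl x≡b (≤-trans (m≤m⊔n (suc x) (blocks r)) blocks≤b)

occurs-from : ∀ {m} l → RGSFrom m l → ∀ {b} → b < m ⊔ blocks l → b < m ⊎ 1 ≤ occ l b
occurs-from {m} [] _ {b} b<m⊔0 = inj₁ (subst (b <_) (⊔-identityʳ m) b<m⊔0)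
occurs-from {m} (x ∷ r) (x≤m , v) {b} b<m⊔blocks
  with occurs-from r v (subst (b <_) (sym (⊔-assoc m (suc x) (blocks r))) b<m⊔blocks)
... | inj₂ 1≤occ = inj₂ (≤-trans 1≤occ (occ-≤-∷ x r b))
... | inj₁ b<m′ with b ≟ x
...   | yes refl = inj₂ (subst (1 ≤_) (sym (occ-here b r)) (s≤s z≤n))
...   | no b≢x = inj₁ (<⊔1+⇒< x≤m b<m′ b≢x)

occurs : ∀ l → RGSFrom 0 l → ∀ {b} → b < blocks l → 1 ≤ occ l b
occurs l v b<blocks with occurs-from l v b<blocks
... | inj₁ ()
... | inj₂ 1≤occ = 1≤occ

length-∑occ : ∀ l {d} → blocks l ≤ d → length l ≡ ∑< d (occ l)
length-∑occ [] {d} _ = sym (∑<-zeros d)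
length-∑occ (x ∷ r) {d} blocks≤d = begin
  1 + length r                               ≡⟨ cong₂ _+_ (sym (∑<-point x<d)) (length-∑occ r blocks-r≤d) ⟩
  ∑< d (λ i → 𝟙 (x ≡ᵇ i)) + ∑< d (occ r)     ≡⟨ ∑<-+ d _ _ ⟨
  ∑< d (λ i → 𝟙 (x ≡ᵇ i) + occ r i)          ≡⟨ ∑<-cong d (λ i _ → occ-∷ x r i) ⟨
  ∑< d (occ (x ∷ r))                         ∎
  where
  open ≡-Reasoning
  x<d = ≤-trans (m≤m⊔n (suc x) (blocks r)) blocks≤d
  blocks-r≤d = ≤-trans (m≤n⊔m (suc x) (blocks r)) blocks≤d

blocks-mono : ∀ l l′ → RGSFrom 0 l → (∀ b → 1 ≤ occ l b → 1 ≤ occ l′ b) → blocks l ≤ blocks l′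
blocks-mono l l′ v occurs⇒ = ≮⇒≥ λ blocks′<blocks →
  contradiction (subst (1 ≤_) (occ-≥blocks l′ ≤-refl) (occurs⇒ _ (occurs l v blocks′<blocks))) λ ()

#blocks : (ℕ → Bool) → List ℕ → ℕ
#blocks p l = ∑< (blocks l) (λ b → 𝟙 (p (occ l b)))

numSingletons≡#blocks : ∀ l → numSingletons (fromList l) ≡ #blocks (_≡ᵇ 1) l
numSingletons≡#blocks l = length-filter-applyUpTo (λ b → blockSize (fromList l) b ≟ 1) id (blocks l)

numDoubletons≡#blocks : ∀ l → numDoubletons (fromList l) ≡ #blocks (_≡ᵇ 2) l
numDoubletons≡#blocks l = length-filter-applyUpTo (λ b → blockSize (fromList l) b ≟ 2) id (blocks l)

#blocks-cong : ∀ p q l l′ → blocks l ≡ blocks l′ → (∀ b → p (occ l b) ≡ q (occ l′ b)) →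
  #blocks p l ≡ #blocks q l′
#blocks-cong p q l l′ blocks≡ p≡q =
  trans (∑<-cong (blocks l) (λ b _ → cong 𝟙 (p≡q b))) (cong (λ d → ∑< d _) blocks≡)

#blocks-+ : ∀ p q r l → RGSFrom 0 l → (∀ c → 1 ≤ c → 𝟙 (p c) + 𝟙 (q c) ≡ 𝟙 (r c)) →
  #blocks p l + #blocks q l ≡ #blocks r l
#blocks-+ p q r l v p+q≡r =
  trans (sym (∑<-+ (blocks l) _ _)) (∑<-cong (blocks l) (λ b b<n → p+q≡r (occ l b) (occurs l v b<n)))

#blocks-true : ∀ l → #blocks (λ _ → true) l ≡ blocks l
#blocks-true l = ∑<-ones (blocks l) (λ _ _ → refl)

-- The pattern 134/2

ContainsXYXX : List ℕ → Set
ContainsXYXX l = ∃₂ λ x y → x ≢ y × x ∷ y ∷ x ∷ x ∷ [] ⊆ l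

ContainsXYXX-mono : ∀ {l l′} → l ⊆ l′ → ContainsXYXX l → ContainsXYXX l′
ContainsXYXX-mono l⊆l′ (x , y , x≢y , p) = x , y , x≢y , ⊆-trans p l⊆l′

⊆-run-++⁻ : ∀ c {x y : ℕ} {ys} E → y ≢ x → y ∷ ys ⊆ replicate c x ++ E → y ∷ ys ⊆ E
⊆-run-++⁻ zero E y≢x p = p
⊆-run-++⁻ (suc c) E y≢x (_ ∷ʳ p) = ⊆-run-++⁻ c E y≢x p
⊆-run-++⁻ (suc c) E y≢x (y≡x ∷ p) = contradiction y≡x y≢x

ContainsXYXX-run-++⁻ : ∀ c {x} E → occ E x ≤ 1 → ContainsXYXX (replicate c x ++ E) → ContainsXYXX E
ContainsXYXX-run-++⁻ zero E _ xyxx = xyxx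
ContainsXYXX-run-++⁻ (suc c) E occ≤1 (a , b , a≢b , _ ∷ʳ p) = ContainsXYXX-run-++⁻ c E occ≤1 (a , b , a≢b , p)
ContainsXYXX-run-++⁻ (suc c) {x} E occ≤1 (.x , b , x≢b , refl ∷ p) = contradiction occ≤1 (<⇒≱ 1<occ)
  where
  xx⊆E : x ∷ x ∷ [] ⊆ E
  xx⊆E = ∷ˡ⁻ (⊆-run-++⁻ c E (x≢b ∘ sym) p)
  1<occ : 1 < occ E x
  1<occ = subst (_≤ occ E x) (occ-replicate 2 x) (⊆⇒occ-≤ xx⊆E x)

run-decomposition : ∀ {x} r {j} → ¬ ContainsXYXX (x ∷ r) → occ r x ≡ suc j →
  ∃ λ r′ → r ≡ replicate j x ++ r′ × occ r′ x ≡ 1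
run-decomposition {x} (y ∷ r) {j} avoids occ≡ with y ≟ x | j
... | yes refl | zero = y ∷ r , refl , occ≡
... | yes refl | suc j′ =
  let r′ , r≡ , occ′≡ = run-decomposition r (avoids ∘ ContainsXYXX-mono (x ∷ʳ ⊆-refl))
                                          (suc-injective (trans (sym (occ-here x r)) occ≡))
  in r′ , cong (x ∷_) r≡ , occ′≡
... | no y≢x | zero = y ∷ r , refl , occ≡
... | no y≢x | suc j′ = contradiction (x , y , y≢x ∘ sym , refl ∷ refl ∷ replicate-⊆ 2 x r 2≤occ) avoids
  where
  2≤occ : 2 ≤ occ r x
  2≤occ = subst (2 ≤_) (trans (sym occ≡) (occ-there r y≢x)) (s≤s (s≤s z≤n))

⊆⇒increasing : ∀ {xs ys : List ℕ} → xs ⊆ ys → Σ (Fin (length xs) → Fin (length ys)) λ ι →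
  StrictlyIncreasing ι × (∀ i → lookup (fromList ys) (ι i) ≡ lookup (fromList xs) i)
⊆⇒increasing [] = (λ ()) , (λ ()) , (λ ())
⊆⇒increasing (y ∷ʳ p) with ⊆⇒increasing p
... | ι , inc , look = suc ∘ ι , (λ i j i<j → s<s (inc i j i<j)) , look
⊆⇒increasing {x ∷ xs} {y ∷ ys} (x≡y ∷ p) with ⊆⇒increasing p
... | ι , inc , look = ι′ , inc′ , look′
  where
  ι′ : Fin (suc (length xs)) → Fin (suc (length ys))
  ι′ zero = zero
  ι′ (suc i) = suc (ι i)
  inc′ : StrictlyIncreasing ι′
  inc′ zero (suc j) _ = z<s
  inc′ (suc i) (suc j) (s<s i<j) = s<s (inc i j i<j)
  look′ : ∀ i → lookup (fromList (y ∷ ys)) (ι′ i) ≡ lookup (fromList (x ∷ xs)) i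
  look′ zero = sym x≡y
  look′ (suc i) = look i

zero-or-positive : ∀ {n} (i : Fin (suc n)) → i ≡ zero ⊎ 0 < toℕ i
zero-or-positive zero = inj₁ refl
zero-or-positive (suc i) = inj₂ z<s

predFin : ∀ {n} (i : Fin (suc n)) → 0 < toℕ i → Fin n
predFin (suc i) _ = i

suc-predFin : ∀ {n} (i : Fin (suc n)) (0<i : 0 < toℕ i) → suc (predFin i 0<i) ≡ i
suc-predFin (suc i) _ = refl

increasing⇒⊆ : ∀ {k} (ys : List ℕ) (ι : Fin k → Fin (length ys)) → StrictlyIncreasing ι →
  tabulate (lookup (fromList ys) ∘ ι) ⊆ ys
increasing⇒⊆ {zero} ys ι inc = []⊆-universal ys
increasing⇒⊆ {suc k} [] ι inc with ι zero
... | ()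
increasing⇒⊆ {suc k} (y ∷ ys) ι inc with zero-or-positive (ι zero)
... | inj₁ ι0≡ = subst (_⊆ y ∷ ys) (cong₂ _∷_ (cong (lookup (fromList (y ∷ ys))) (sym ι0≡)) (tabulate-cong shift-look))
                     (refl ∷ increasing⇒⊆ ys ι′ inc′)
  where
  pos : ∀ i → 0 < toℕ (ι (suc i))
  pos i = subst (λ a → toℕ a < toℕ (ι (suc i))) ι0≡ (inc zero (suc i) z<s)
  ι′ : Fin k → Fin (length ys)
  ι′ i = predFin (ι (suc i)) (pos i)
  inc′ : StrictlyIncreasing ι′
  inc′ i j i<j = s<s⁻¹ (subst₂ (λ a b → toℕ a < toℕ b) (sym (suc-predFin _ (pos i))) (sym (suc-predFin _ (pos j)))
                                (inc (suc i) (suc j) (s<s i<j)))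
  shift-look : ∀ i → lookup (fromList ys) (ι′ i) ≡ lookup (fromList (y ∷ ys)) (ι (suc i))
  shift-look i = cong (lookup (fromList (y ∷ ys))) (suc-predFin _ (pos i))
... | inj₂ 0<ι0 = subst (_⊆ y ∷ ys) (tabulate-cong shift-look) (y ∷ʳ increasing⇒⊆ ys ι′ inc′)
  where
  pos : ∀ i → 0 < toℕ (ι i)
  pos zero = 0<ι0
  pos (suc i) = <-trans (pos zero) (inc zero (suc i) z<s)
  ι′ : Fin (suc k) → Fin (length ys)
  ι′ i = predFin (ι i) (pos i)
  inc′ : StrictlyIncreasing ι′
  inc′ i j i<j = s<s⁻¹ (subst₂ (λ a b → toℕ a < toℕ b) (sym (suc-predFin _ (pos i))) (sym (suc-predFin _ (pos j)))
                                (inc i j i<j))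
  shift-look : ∀ i → lookup (fromList ys) (ι′ i) ≡ lookup (fromList (y ∷ ys)) (ι i)
  shift-look i = cong (lookup (fromList (y ∷ ys))) (suc-predFin _ (pos i))

-- x y x x is the image of 134/2 = 0100 under 0 ↦ x, 1 ↦ y.
xyLetter : ℕ → ℕ → ℕ → ℕ
xyLetter x y zero = x
xyLetter x y (suc _) = y

xyLetter-injective : ∀ {x y a b} → x ≢ y → a ≤ 1 → b ≤ 1 → xyLetter x y a ≡ xyLetter x y b → a ≡ b
xyLetter-injective x≢y z≤n z≤n _ = refl
xyLetter-injective x≢y z≤n (s≤s z≤n) x≡y = contradiction x≡y x≢y
xyLetter-injective x≢y (s≤s z≤n) z≤n y≡x = contradiction (sym y≡x) x≢y
xyLetter-injective x≢y (s≤s z≤n) (s≤s z≤n) _ = refl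

p134/2≤1 : ∀ i → lookup (proj₁ p134/2) i ≤ 1
p134/2≤1 zero = z≤n
p134/2≤1 (suc zero) = s≤s z≤n
p134/2≤1 (suc (suc zero)) = z≤n
p134/2≤1 (suc (suc (suc zero))) = z≤n

xyxx⇒contains : ∀ l rg → ContainsXYXX l → Contains (fromList l , rg) p134/2
xyxx⇒contains l rg (x , y , x≢y , p) with ⊆⇒increasing p
... | ι , inc , look = ι , inc , λ i j →
  (λ same → xyLetter-injective x≢y (p134/2≤1 i) (p134/2≤1 j) (trans (sym (letters i)) (trans same (letters j)))) ,
  (λ same → trans (letters i) (trans (cong (xyLetter x y) same) (sym (letters j))))
  where
  letters : ∀ i → lookup (fromList l) (ι i) ≡ xyLetter x y (lookup (proj₁ p134/2) i)
  letters i = trans (look i) (lookup-map i (xyLetter x y) (proj₁ p134/2))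

contains⇒xyxx : ∀ l rg → Contains (fromList l , rg) p134/2 → ContainsXYXX l
contains⇒xyxx l rg (ι , inc , same) =
  a zero , a (suc zero) , (λ a0≡a1 → 0≢1+n (proj₁ (same zero (suc zero)) a0≡a1)) ,
  subst₂ (λ u w → a zero ∷ a (suc zero) ∷ u ∷ w ∷ [] ⊆ l)
         (sym (proj₂ (same zero (suc (suc zero))) refl)) (sym (proj₂ (same zero (suc (suc (suc zero)))) refl))
         (increasing⇒⊆ l ι inc)
  where
  a : Fin 4 → ℕ
  a = lookup (fromList l) ∘ ι

-- Compression and expansion

-- Reading a restricted growth string from the left with m blocks opened so far, a letter x followed
-- by r opens a new block iff x ≡ m, and is the last element of its block iff x does not occur in r.
data Kind : Set where
  opening : ℕ → Kind
  middle final : Kind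

kindOf : ℕ → Bool → Kind
kindOf zero _ = final
kindOf (suc j) true = opening j
kindOf (suc j) false = middle

kind : ℕ → ℕ → List ℕ → Kind
kind m x r = kindOf (occ r x) (x ≡ᵇ m)

data Classify (m x : ℕ) (r : List ℕ) : Kind → Set where
  opening : ∀ j → x ≡ m → occ r x ≡ suc j → Classify m x r (opening j)
  middle : x ≢ m → 1 ≤ occ r x → Classify m x r middle
  final : occ r x ≡ 0 → Classify m x r final

classify : ∀ m x r → Classify m x r (kind m x r)
classify m x r with occ r x in occ≡ | x ≡ᵇ m in x≡ᵇm
... | zero | _ = final occ≡
... | suc j | true = opening j (≡ᵇ⇒≡ x m (subst T (sym x≡ᵇm) _)) occ≡
... | suc j | false = middle (λ x≡m → subst T x≡ᵇm (≡⇒≡ᵇ x m x≡m)) (subst (1 ≤_) (sym occ≡) (s≤s z≤n))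

kind-opening : ∀ {m x r j} → x ≡ m → occ r x ≡ suc j → kind m x r ≡ opening j
kind-opening x≡m occ≡ = cong₂ kindOf occ≡ (≡ᵇ-true x≡m)

kind-middle : ∀ {m x r} → x ≢ m → 1 ≤ occ r x → kind m x r ≡ middle
kind-middle {m} {x} {r} x≢m 1≤occ with occ r x
... | suc _ = cong (kindOf (suc _)) (≡ᵇ-false x≢m)

kind-final : ∀ {m x r} → occ r x ≡ 0 → kind m x r ≡ final
kind-final {m} {x} occ≡0 = cong (λ c → kindOf c (x ≡ᵇ m)) occ≡0

compress : ℕ → List ℕ → List ℕ
compress m [] = []
compress m (x ∷ r) with kind m x r
... | middle = compress (m ⊔ suc x) r
... | _ = x ∷ compress (m ⊔ suc x) r

composition : ℕ → List ℕ → List ℕ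
composition m [] = []
composition m (x ∷ r) with kind m x r
... | opening j = j ∷ composition (m ⊔ suc x) r
... | _ = composition (m ⊔ suc x) r

expand : ℕ → List ℕ → List ℕ → List ℕ
expand m [] cs = []
expand m (x ∷ r) cs with kind m x r | cs
... | opening _ | c ∷ cs′ = x ∷ replicate c x ++ expand (m ⊔ suc x) r cs′
... | _ | cs′ = x ∷ expand (m ⊔ suc x) r cs′

compress-∷-kept : ∀ {m x} r → x ≡ m ⊎ occ r x ≡ 0 → compress m (x ∷ r) ≡ x ∷ compress (m ⊔ suc x) r
compress-∷-kept {m} {x} r kept with kind m x r | classify m x r
... | _ | opening _ _ _ = refl
... | _ | final _ = refl
... | _ | middle x≢m 1≤occ with kept
...   | inj₁ x≡m = contradiction x≡m x≢m
...   | inj₂ occ≡0 = contradiction (subst (1 ≤_) occ≡0 1≤occ) λ ()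

composition-∷-≢ : ∀ {m x} r → x ≢ m → composition m (x ∷ r) ≡ composition (m ⊔ suc x) r
composition-∷-≢ {m} {x} r x≢m with kind m x r | classify m x r
... | _ | opening _ x≡m _ = contradiction x≡m x≢m
... | _ | middle _ _ = refl
... | _ | final _ = refl

composition-∷-opening : ∀ {m x} r {j} → x ≡ m → occ r x ≡ suc j →
  composition m (x ∷ r) ≡ j ∷ composition (m ⊔ suc x) r
composition-∷-opening {m} {x} r x≡m occ≡ rewrite kind-opening {m} {x} {r} x≡m occ≡ = refl

composition-∷-final : ∀ {m x} r → occ r x ≡ 0 → composition m (x ∷ r) ≡ composition (m ⊔ suc x) r
composition-∷-final {m} {x} r occ≡0 rewrite kind-final {m} {x} {r} occ≡0 = refl

length-composition-∷-opening : ∀ m r →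
  length (composition m (m ∷ r)) ≡ 𝟙 (1 ≤ᵇ occ r m) + length (composition (suc m) r)
length-composition-∷-opening m r with kind m m r | classify m m r
... | _ | opening j _ occ≡ rewrite occ≡ | m≤n⇒m⊔n≡n (n≤1+n m) = refl
... | _ | middle m≢m _ = contradiction refl m≢m
... | _ | final occ≡0 rewrite occ≡0 | m≤n⇒m⊔n≡n (n≤1+n m) = refl

expand-∷-opening : ∀ {m x} r {j c cs} → x ≡ m → occ r x ≡ suc j →
  expand m (x ∷ r) (c ∷ cs) ≡ x ∷ replicate c x ++ expand (m ⊔ suc x) r cs
expand-∷-opening {m} {x} r x≡m occ≡ rewrite kind-opening {m} {x} {r} x≡m occ≡ = refl

expand-∷-final : ∀ {m x} r {cs} → occ r x ≡ 0 → expand m (x ∷ r) cs ≡ x ∷ expand (m ⊔ suc x) r cs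
expand-∷-final {m} {x} r occ≡0 rewrite kind-final {m} {x} {r} occ≡0 = refl

expand-∷ : ∀ m x r cs → ∃₂ λ c cs′ → (c ≡ 0 ⊎ x ≡ m) ×
  expand m (x ∷ r) cs ≡ x ∷ replicate c x ++ expand (m ⊔ suc x) r cs′
expand-∷ m x r cs with kind m x r | classify m x r | cs
... | _ | opening _ x≡m _ | c ∷ cs′ = c , cs′ , inj₂ x≡m , refl
... | _ | opening _ _ _ | [] = 0 , [] , inj₁ refl , refl
... | _ | middle _ _ | cs′ = 0 , cs′ , inj₁ refl , refl
... | _ | final _ | cs′ = 0 , cs′ , inj₁ refl , refl

compress-valid : ∀ {m} l → RGSFrom m l → RGSFrom m (compress m l)
compress-valid [] v = v
compress-valid {m} (x ∷ r) (x≤m , v) with kind m x r | classify m x r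
... | _ | opening _ _ _ = x≤m , compress-valid r v
... | _ | final _ = x≤m , compress-valid r v
... | _ | middle x≢m _ =
  subst (λ m′ → RGSFrom m′ (compress (m ⊔ suc x) r)) (m⊔1+x≡m (≤∧≢⇒< x≤m x≢m)) (compress-valid r v)

occ-compress-∷-≢ : ∀ m x r {b} → x ≢ b → occ (compress m (x ∷ r)) b ≡ occ (compress (m ⊔ suc x) r) b
occ-compress-∷-≢ m x r x≢b with kind m x r
... | opening _ = occ-there (compress (m ⊔ suc x) r) x≢b
... | middle = refl
... | final = occ-there (compress (m ⊔ suc x) r) x≢b

-- Only the first and the last element of each block survive; for blocks opened before
-- position m the first one is already gone.
occ-compress : ∀ {m} l → RGSFrom m l → ∀ b →
  (m ≤ b → occ (compress m l) b ≡ occ l b ⊓ 2) × (b < m → occ (compress m l) b ≡ occ l b ⊓ 1)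
occ-compress [] _ b = (λ _ → refl) , (λ _ → refl)
occ-compress {m} (x ∷ r) (x≤m , v) b with x ≟ b
... | no x≢b =
  (λ m≤b → tail≡ (_⊓ 2) (proj₁ (occ-compress r v b) (m⊔1+x≤b x≤m m≤b x≢b))) ,
  (λ b<m → tail≡ (_⊓ 1) (proj₂ (occ-compress r v b) (<-≤-trans b<m (m≤m⊔n m (suc x)))))
  where
  tail≡ : ∀ f → occ (compress (m ⊔ suc x) r) b ≡ f (occ r b) → occ (compress m (x ∷ r)) b ≡ f (occ (x ∷ r) b)
  tail≡ f eq = trans (occ-compress-∷-≢ m x r x≢b) (trans eq (cong f (sym (occ-there r x≢b))))
... | yes refl with kind m x r | classify m x r
...   | _ | opening j refl occ≡ = (λ _ → two) , (λ m<m → contradiction m<m (<-irrefl refl))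
  where
  two : occ (x ∷ compress (x ⊔ suc x) r) x ≡ occ (x ∷ r) x ⊓ 2
  two rewrite occ-here x (compress (x ⊔ suc x) r) | proj₂ (occ-compress r v x) (x<m⊔1+x x x)
            | occ-here x r | occ≡ | m≥n⇒m⊓n≡n (s≤s (z≤n {j})) = refl
...   | _ | final occ≡0 = (λ _ → one) , (λ _ → one)
  where
  one : ∀ {k} → occ (x ∷ compress (m ⊔ suc x) r) x ≡ occ (x ∷ r) x ⊓ suc k
  one {k} rewrite occ-here x (compress (m ⊔ suc x) r) | proj₂ (occ-compress r v x) (x<m⊔1+x m x)
                | occ-here x r =
    trans (cong (λ c → suc (c ⊓ 1)) occ≡0) (cong (λ c → suc (c ⊓ k)) (sym occ≡0))
...   | _ | middle x≢m 1≤occ = (λ m≤x → contradiction m≤x (<⇒≱ x<m)) , (λ _ → one)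
  where
  x<m = ≤∧≢⇒< x≤m x≢m
  one : occ (compress (m ⊔ suc x) r) x ≡ occ (x ∷ r) x ⊓ 1
  one rewrite proj₂ (occ-compress r v x) (x<m⊔1+x m x) | occ-here x r
            | m≥n⇒m⊓n≡n 1≤occ | m≥n⇒m⊓n≡n (s≤s (z≤n {occ r x})) = refl

occ-compress₀ : ∀ l → RGSFrom 0 l → ∀ b → occ (compress 0 l) b ≡ occ l b ⊓ 2
occ-compress₀ l v b = proj₁ (occ-compress l v b) z≤n

blocks-compress : ∀ l → RGSFrom 0 l → blocks (compress 0 l) ≡ blocks l
blocks-compress l v = ≤-antisym
  (blocks-mono (compress 0 l) l (compress-valid l v) λ b 1≤occ →
    ≤-trans 1≤occ (≤-trans (≤-reflexive (occ-compress₀ l v b)) (m⊓n≤m (occ l b) 2)))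
  (blocks-mono l (compress 0 l) v λ b 1≤occ →
    subst (1 ≤_) (sym (occ-compress₀ l v b)) (⊓-glb 1≤occ (s≤s z≤n)))

length-composition : ∀ {m} l → RGSFrom m l → ∀ d → blocks l ≤ d + m →
  length (composition m l) ≡ ∑< d (λ i → 𝟙 (2 ≤ᵇ occ l (i + m)))
length-composition [] _ d _ = sym (∑<-zeros d)
length-composition {m} (x ∷ r) (x≤m , v) d bound with x ≟ m
... | no x≢m rewrite composition-∷-≢ {m} {x} r x≢m | m⊔1+x≡m (≤∧≢⇒< x≤m x≢m) =
  trans (length-composition r v d (≤-trans (m≤n⊔m (suc x) (blocks r)) bound))
        (∑<-cong d (λ i _ → cong (λ c → 𝟙 (2 ≤ᵇ c)) (sym (occ-there r (x≢i+m i)))))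
  where
  x<m = ≤∧≢⇒< x≤m x≢m
  x≢i+m : ∀ i → x ≢ i + m
  x≢i+m i x≡i+m = <⇒≱ x<m (subst (m ≤_) (sym x≡i+m) (m≤n+m m i))
... | yes refl with d
...   | zero = contradiction (≤-trans (m≤m⊔n (suc x) (blocks r)) bound) (<-irrefl refl)
...   | suc d′ rewrite m≤n⇒m⊔n≡n (n≤1+n x) = begin
  length (composition x (x ∷ r))                                ≡⟨ length-composition-∷-opening x r ⟩
  𝟙 (1 ≤ᵇ occ r x) + length (composition (suc x) r)
    ≡⟨ cong (𝟙 (1 ≤ᵇ occ r x) +_) (length-composition r v d′ bound′) ⟩
  𝟙 (1 ≤ᵇ occ r x) + ∑< d′ (λ i → 𝟙 (2 ≤ᵇ occ r (i + suc x)))   ≡⟨ cong₂ _+_ first (∑<-cong d′ λ i _ → shifted i) ⟩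
  ∑< (suc d′) (λ i → 𝟙 (2 ≤ᵇ occ (x ∷ r) (i + x)))               ∎
  where
  open ≡-Reasoning
  bound′ : blocks r ≤ d′ + suc x
  bound′ = subst (blocks r ≤_) (sym (+-suc d′ x)) (≤-trans (m≤n⊔m (suc x) (blocks r)) bound)
  first : 𝟙 (1 ≤ᵇ occ r x) ≡ 𝟙 (2 ≤ᵇ occ (x ∷ r) x)
  first = cong (λ c → 𝟙 (2 ≤ᵇ c)) (sym (occ-here x r))
  shifted : ∀ i → 𝟙 (2 ≤ᵇ occ r (i + suc x)) ≡ 𝟙 (2 ≤ᵇ occ (x ∷ r) (suc i + x))
  shifted i = cong (λ c → 𝟙 (2 ≤ᵇ c))
    (trans (cong (occ r) (+-suc i x)) (sym (occ-there r (λ x≡ → <-irrefl x≡ (s≤s (m≤n+m x i))))))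

run-valid : ∀ c {x m} l → x < m → RGSFrom m l → RGSFrom m (replicate c x ++ l)
run-valid zero l _ v = v
run-valid (suc c) {x} {m} l x<m v =
  <⇒≤ x<m , subst (λ m′ → RGSFrom m′ (replicate c x ++ l)) (sym (m⊔1+x≡m x<m)) (run-valid c l x<m v)

run-valid⁻ : ∀ c {x m} l → x < m → RGSFrom m (replicate c x ++ l) → RGSFrom m l
run-valid⁻ zero l _ v = v
run-valid⁻ (suc c) {x} {m} l x<m (_ , v) =
  run-valid⁻ c l x<m (subst (λ m′ → RGSFrom m′ (replicate c x ++ l)) (m⊔1+x≡m x<m) v)

compress-run : ∀ c {x m} l → x < m → 1 ≤ occ l x → compress m (replicate c x ++ l) ≡ compress m l
compress-run zero l _ _ = refl
compress-run (suc c) {x} {m} l x<m 1≤occ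
  rewrite kind-middle {m} {x} {replicate c x ++ l} (<⇒≢ x<m) (≤-trans 1≤occ (occ-≤-++ (replicate c x) l x))
        | m⊔1+x≡m x<m = compress-run c l x<m 1≤occ

composition-run : ∀ c {x m} l → x < m → composition m (replicate c x ++ l) ≡ composition m l
composition-run zero l _ = refl
composition-run (suc c) {x} {m} l x<m
  rewrite composition-∷-≢ {m} {x} (replicate c x ++ l) (<⇒≢ x<m) | m⊔1+x≡m x<m = composition-run c l x<m

AtMostOnceBelow : ℕ → List ℕ → Set
AtMostOnceBelow m l = ∀ b → b < m → occ l b ≤ 1

AtMostOnceBelow-∷ : ∀ {x m} l s → x ≤ m → AtMostOnceBelow m l → (∀ b → occ s b ≤ occ l b) → occ s x ≤ 1 →
  AtMostOnceBelow (m ⊔ suc x) s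
AtMostOnceBelow-∷ {x} l s x≤m once s≤l occ≤1 b b<m′ with b ≟ x
... | yes refl = occ≤1
... | no b≢x = ≤-trans (s≤l b) (once b (<⊔1+⇒< x≤m b<m′ b≢x))

Matching : ℕ → List ℕ → Set
Matching m w = (∀ b → occ w b ≤ 2) × AtMostOnceBelow m w

Matching-∷ : ∀ {x m r} → x ≤ m → Matching m (x ∷ r) → Matching (m ⊔ suc x) r
Matching-∷ {x} {m} {r} x≤m (≤2 , once) =
  (λ b → ≤-trans (occ-≤-∷ x r b) (≤2 b)) ,
  AtMostOnceBelow-∷ (x ∷ r) r x≤m once (occ-≤-∷ x r) (s≤s⁻¹ (subst (_≤ 2) (occ-here x r) (≤2 x)))

expand-valid : ∀ {m} w cs → RGSFrom m w → RGSFrom m (expand m w cs)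
expand-valid [] cs v = v
expand-valid {m} (x ∷ r) cs (x≤m , v) with expand-∷ m x r cs
... | c , cs′ , _ , eq rewrite eq = x≤m , run-valid c _ (x<m⊔1+x m x) (expand-valid r cs′ v)

occ-expand-< : ∀ {m} w cs {b} → b < m → occ (expand m w cs) b ≡ occ w b
occ-expand-< [] cs b<m = refl
occ-expand-< {m} (x ∷ r) cs {b} b<m with expand-∷ m x r cs
... | c , cs′ , c≡0⊎x≡m , eq rewrite eq with x ≟ b
...   | no x≢b = begin
  occ (replicate (suc c) x ++ E) b         ≡⟨ occ-++ (replicate (suc c) x) E b ⟩
  occ (replicate (suc c) x) b + occ E b    ≡⟨ cong (_+ occ E b) (occ-replicate-≢ (suc c) x≢b) ⟩
  occ E b                                  ≡⟨ IH ⟩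
  occ r b                                  ≡⟨ occ-there r x≢b ⟨
  occ (x ∷ r) b                            ∎
  where
  open ≡-Reasoning
  E = expand (m ⊔ suc x) r cs′
  IH = occ-expand-< r cs′ (<-≤-trans b<m (m≤m⊔n m (suc x)))
...   | yes refl with c≡0⊎x≡m
...     | inj₂ refl = contradiction b<m (<-irrefl refl)
...     | inj₁ refl = trans (occ-here x E) (trans (cong suc (occ-expand-< r cs′ (<-≤-trans b<m (m≤m⊔n m (suc x)))))
                                               (sym (occ-here x r)))
  where E = expand (m ⊔ suc x) r cs′

expand-avoids : ∀ {m} w cs → RGSFrom m w → Matching m w → ¬ ContainsXYXX (expand m w cs)
expand-avoids [] cs _ _ (_ , _ , _ , ())
expand-avoids {m} (x ∷ r) cs (x≤m , v) matching xyxx with expand-∷ m x r cs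
... | c , cs′ , _ , eq = expand-avoids r cs′ v (Matching-∷ {r = r} x≤m matching)
  (ContainsXYXX-run-++⁻ (suc c) E occ-E≤1 (subst ContainsXYXX eq xyxx))
  where
  E = expand (m ⊔ suc x) r cs′
  occ-E≤1 : occ E x ≤ 1
  occ-E≤1 = subst (_≤ 1) (sym (occ-expand-< r cs′ (x<m⊔1+x m x)))
                  (s≤s⁻¹ (subst (_≤ 2) (occ-here x r) (proj₁ matching x)))

length-expand : ∀ {m} w cs → length cs ≡ length (composition m w) → length (expand m w cs) ≡ length w + sum cs
length-expand [] [] _ = refl
length-expand [] (_ ∷ _) ()
length-expand {m} (x ∷ r) cs len≡ with kind m x r | cs
... | opening j | c ∷ cs′ = cong suc (begin
  length (replicate c x ++ E)     ≡⟨ length-++ (replicate c x) ⟩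
  length (replicate c x) + length E ≡⟨ cong₂ _+_ (length-replicate c) (length-expand r cs′ (suc-injective len≡)) ⟩
  c + (length r + sum cs′)        ≡⟨ x∙yz≈y∙xz c (length r) (sum cs′) ⟩
  length r + (c + sum cs′)        ∎)
  where
  open ≡-Reasoning
  E = expand (m ⊔ suc x) r cs′
... | middle | cs′ = cong suc (length-expand r cs′ len≡)
... | final | cs′ = cong suc (length-expand r cs′ len≡)

-- Compression and expansion are mutually inverse

middle-violates-once : ∀ {m x} r → x ≤ m → x ≢ m → 1 ≤ occ r x → ¬ AtMostOnceBelow m (x ∷ r)
middle-violates-once {x = x} r x≤m x≢m 1≤occ once =
  <⇒≱ (subst (1 <_) (sym (occ-here x r)) (s≤s 1≤occ)) (once x (≤∧≢⇒< x≤m x≢m))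

compress∘expand : ∀ {m} w cs → RGSFrom m w → Matching m w → length cs ≡ length (composition m w) →
  compress m (expand m w cs) ≡ w × composition m (expand m w cs) ≡ cs
compress∘expand [] [] _ _ _ = refl , refl
compress∘expand [] (_ ∷ _) _ _ ()
compress∘expand {m} (x ∷ r) cs (x≤m , v) matching len≡ with kind m x r | classify m x r | cs
... | _ | middle x≢m 1≤occ | _ = contradiction (proj₂ matching) (middle-violates-once r x≤m x≢m 1≤occ)
... | _ | final occ≡0 | cs′ =
  trans (compress-∷-kept E (inj₂ occ-E≡0)) (cong (x ∷_) (proj₁ IH)) , trans (composition-∷-final E occ-E≡0) (proj₂ IH)
  where
  E = expand (m ⊔ suc x) r cs′
  IH = compress∘expand r cs′ v (Matching-∷ {r = r} x≤m matching) len≡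
  occ-E≡0 : occ E x ≡ 0
  occ-E≡0 = trans (occ-expand-< r cs′ (x<m⊔1+x m x)) occ≡0
... | _ | opening j refl occ≡ | [] = contradiction len≡ 0≢1+n
... | _ | opening j refl occ≡ | c ∷ cs′ = compress≡ , composition≡
  where
  open ≡-Reasoning
  E = expand (x ⊔ suc x) r cs′
  matching′ = Matching-∷ {r = r} x≤m matching
  IH = compress∘expand r cs′ v matching′ (suc-injective len≡)
  occ-E≡1 : occ E x ≡ 1
  occ-E≡1 = trans (occ-expand-< r cs′ (x<m⊔1+x x x))
                  (≤-antisym (proj₂ matching′ x (x<m⊔1+x x x)) (subst (1 ≤_) (sym occ≡) (s≤s z≤n)))
  occ-run≡ : occ (replicate c x ++ E) x ≡ suc c
  occ-run≡ = trans (occ-++ (replicate c x) E x) (trans (cong₂ _+_ (occ-replicate c x) occ-E≡1) (+-comm c 1))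
  compress≡ : compress x (x ∷ replicate c x ++ E) ≡ x ∷ r
  compress≡ = begin
    compress x (x ∷ replicate c x ++ E)             ≡⟨ compress-∷-kept (replicate c x ++ E) (inj₁ refl) ⟩
    x ∷ compress (x ⊔ suc x) (replicate c x ++ E)
      ≡⟨ cong (x ∷_) (compress-run c E (x<m⊔1+x x x) (≤-reflexive (sym occ-E≡1))) ⟩
    x ∷ compress (x ⊔ suc x) E                      ≡⟨ cong (x ∷_) (proj₁ IH) ⟩
    x ∷ r                                           ∎
  composition≡ : composition x (x ∷ replicate c x ++ E) ≡ c ∷ cs′
  composition≡ = begin
    composition x (x ∷ replicate c x ++ E)             ≡⟨ composition-∷-opening (replicate c x ++ E) refl occ-run≡ ⟩
    c ∷ composition (x ⊔ suc x) (replicate c x ++ E)   ≡⟨ cong (c ∷_) (composition-run c E (x<m⊔1+x x x)) ⟩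
    c ∷ composition (x ⊔ suc x) E                      ≡⟨ cong (c ∷_) (proj₂ IH) ⟩
    c ∷ cs′                                            ∎

-- The recursive call skips a whole run, hence the accessibility argument.
expand∘compress : ∀ {m} l → RGSFrom m l → ¬ ContainsXYXX l → AtMostOnceBelow m l → Acc _<_ (length l) →
  expand m (compress m l) (composition m l) ≡ l
expand∘compress [] _ _ _ _ = refl
expand∘compress {m} (x ∷ r) (x≤m , v) avoids once (acc smaller) with kind m x r | classify m x r
... | _ | middle x≢m 1≤occ = contradiction once (middle-violates-once r x≤m x≢m 1≤occ)
... | _ | final occ≡0 = trans (expand-∷-final (compress (m ⊔ suc x) r) occ-C≡0) (cong (x ∷_) IH)
  where
  occ-C≡0 : occ (compress (m ⊔ suc x) r) x ≡ 0
  occ-C≡0 = trans (proj₂ (occ-compress r v x) (x<m⊔1+x m x)) (cong (_⊓ 1) occ≡0)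
  IH = expand∘compress r v (avoids ∘ ContainsXYXX-mono (x ∷ʳ ⊆-refl))
         (AtMostOnceBelow-∷ (x ∷ r) r x≤m once (occ-≤-∷ x r) (subst (_≤ 1) (sym occ≡0) z≤n)) (smaller ≤-refl)
... | _ | opening j refl occ≡ with run-decomposition r avoids occ≡
...   | r′ , refl , occ′≡1 = begin
  expand x (x ∷ compress m′ (replicate j x ++ r′)) (j ∷ composition m′ (replicate j x ++ r′))
    ≡⟨ cong₂ (λ w cs → expand x (x ∷ w) (j ∷ cs)) (compress-run j r′ x<m′ (≤-reflexive (sym occ′≡1)))
                                                  (composition-run j r′ x<m′) ⟩
  expand x (x ∷ compress m′ r′) (j ∷ composition m′ r′)
    ≡⟨ expand-∷-opening (compress m′ r′) refl (trans (proj₂ (occ-compress r′ v′ x) x<m′) (cong (_⊓ 1) occ′≡1)) ⟩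
  x ∷ replicate j x ++ expand m′ (compress m′ r′) (composition m′ r′)
    ≡⟨ cong (λ t → x ∷ replicate j x ++ t) IH ⟩
  x ∷ replicate j x ++ r′ ∎
  where
  open ≡-Reasoning
  m′ = x ⊔ suc x
  x<m′ = x<m⊔1+x x x
  v′ : RGSFrom m′ r′
  v′ = run-valid⁻ j r′ x<m′ v
  IH = expand∘compress r′ v′ (avoids ∘ ContainsXYXX-mono (++⁺ˡ (x ∷ replicate j x) ⊆-refl))
         (AtMostOnceBelow-∷ (x ∷ replicate j x ++ r′) r′ x≤m once (occ-≤-++ (x ∷ replicate j x) r′) (≤-reflexive occ′≡1))
         (smaller (s≤s (subst (length r′ ≤_) (sym (length-++ (replicate j x))) (m≤n+m (length r′) _))))

single-or-multiple : ∀ c → 1 ≤ c → 𝟙 (c ≡ᵇ 1) + 𝟙 (2 ≤ᵇ c) ≡ 𝟙 true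
single-or-multiple (suc zero) _ = refl
single-or-multiple (suc (suc c)) _ = refl

double-or-large : ∀ c → 1 ≤ c → 𝟙 (c ≡ᵇ 2) + 𝟙 (3 ≤ᵇ c) ≡ 𝟙 (2 ≤ᵇ c)
double-or-large (suc zero) _ = refl
double-or-large (suc (suc zero)) _ = refl
double-or-large (suc (suc (suc c))) _ = refl

≡ᵇ1-⊓2 : ∀ c → (c ⊓ 2 ≡ᵇ 1) ≡ (c ≡ᵇ 1)
≡ᵇ1-⊓2 zero = refl
≡ᵇ1-⊓2 (suc zero) = refl
≡ᵇ1-⊓2 (suc (suc c)) = refl

≡ᵇ2-⊓2 : ∀ c → (c ⊓ 2 ≡ᵇ 2) ≡ (2 ≤ᵇ c)
≡ᵇ2-⊓2 zero = refl
≡ᵇ2-⊓2 (suc zero) = refl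
≡ᵇ2-⊓2 (suc (suc c)) rewrite ⊓-zeroʳ c = refl

2≤ᵇ-⊓2 : ∀ c → (2 ≤ᵇ c ⊓ 2) ≡ (2 ≤ᵇ c)
2≤ᵇ-⊓2 zero = refl
2≤ᵇ-⊓2 (suc zero) = refl
2≤ᵇ-⊓2 (suc (suc c)) = refl

2≤ᵇ-≤2 : ∀ {c} → c ≤ 2 → (2 ≤ᵇ c) ≡ (c ≡ᵇ 2)
2≤ᵇ-≤2 z≤n = refl
2≤ᵇ-≤2 (s≤s z≤n) = refl
2≤ᵇ-≤2 (s≤s (s≤s z≤n)) = refl

3≤ᵇ-false : ∀ c → 𝟙 (3 ≤ᵇ c) ≡ 0 → c ≤ 2
3≤ᵇ-false zero _ = z≤n
3≤ᵇ-false (suc zero) _ = s≤s z≤n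
3≤ᵇ-false (suc (suc zero)) _ = s≤s (s≤s z≤n)

≤2-as-indicators : ∀ {c} → c ≤ 2 → c ≡ 𝟙 (c ≡ᵇ 1) + 𝟙 (c ≡ᵇ 2) + 𝟙 (c ≡ᵇ 2)
≤2-as-indicators z≤n = refl
≤2-as-indicators (s≤s z≤n) = refl
≤2-as-indicators (s≤s (s≤s z≤n)) = refl

#blocks-compress : ∀ p q l → RGSFrom 0 l → (∀ c → p (c ⊓ 2) ≡ q c) → #blocks p (compress 0 l) ≡ #blocks q l
#blocks-compress p q l v p≡q =
  #blocks-cong p q (compress 0 l) l (blocks-compress l v) (λ b → trans (cong p (occ-compress₀ l v b)) (p≡q (occ l b)))

singletons+multiples : ∀ l → RGSFrom 0 l → #blocks (_≡ᵇ 1) l + #blocks (2 ≤ᵇ_) l ≡ blocks l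
singletons+multiples l v = trans (#blocks-+ (_≡ᵇ 1) (2 ≤ᵇ_) (λ _ → true) l v single-or-multiple) (#blocks-true l)

length-composition₀ : ∀ l → RGSFrom 0 l → length (composition 0 l) ≡ #blocks (2 ≤ᵇ_) l
length-composition₀ l v =
  trans (length-composition l v (blocks l) (m≤m+n (blocks l) 0))
        (∑<-cong (blocks l) (λ i _ → cong (λ b → 𝟙 (2 ≤ᵇ occ l b)) (+-identityʳ i)))

length-≤2 : ∀ l → (∀ b → occ l b ≤ 2) →
  length l ≡ #blocks (_≡ᵇ 1) l + #blocks (_≡ᵇ 2) l + #blocks (_≡ᵇ 2) l
length-≤2 l ≤2 = begin
  length l                                    ≡⟨ length-∑occ l ≤-refl ⟩
  ∑< (blocks l) (occ l)                       ≡⟨ ∑<-cong (blocks l) (λ b _ → ≤2-as-indicators (≤2 b)) ⟩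
  ∑< (blocks l) (λ b → ind₁ b + ind₂ b + ind₂ b)              ≡⟨ ∑<-+ (blocks l) _ ind₂ ⟩
  ∑< (blocks l) (λ b → ind₁ b + ind₂ b) + ∑< (blocks l) ind₂   ≡⟨ cong (_+ ∑< (blocks l) ind₂) (∑<-+ (blocks l) ind₁ ind₂) ⟩
  #blocks (_≡ᵇ 1) l + #blocks (_≡ᵇ 2) l + #blocks (_≡ᵇ 2) l   ∎
  where
  open ≡-Reasoning
  ind₁ ind₂ : ℕ → ℕ
  ind₁ b = 𝟙 (occ l b ≡ᵇ 1)
  ind₂ b = 𝟙 (occ l b ≡ᵇ 2)

occ≤2 : ∀ l → RGSFrom 0 l → #blocks (_≡ᵇ 1) l + #blocks (_≡ᵇ 2) l ≡ blocks l → ∀ b → occ l b ≤ 2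
occ≤2 l v counted b with b <? blocks l
... | no b≮blocks = subst (_≤ 2) (sym (occ-≥blocks l (≮⇒≥ b≮blocks))) z≤n
... | yes b<blocks = 3≤ᵇ-false (occ l b) (∑<≡0⇒≡0 (blocks l) _ no-large b<blocks)
  where
  no-large : #blocks (3 ≤ᵇ_) l ≡ 0
  no-large = +-cancelˡ-≡ (#blocks (_≡ᵇ 1) l + #blocks (_≡ᵇ 2) l) _ 0 (begin
    #blocks (_≡ᵇ 1) l + #blocks (_≡ᵇ 2) l + #blocks (3 ≤ᵇ_) l   ≡⟨ +-assoc (#blocks (_≡ᵇ 1) l) _ _ ⟩
    #blocks (_≡ᵇ 1) l + (#blocks (_≡ᵇ 2) l + #blocks (3 ≤ᵇ_) l)
      ≡⟨ cong (#blocks (_≡ᵇ 1) l +_) (#blocks-+ (_≡ᵇ 2) (3 ≤ᵇ_) (2 ≤ᵇ_) l v double-or-large) ⟩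
    #blocks (_≡ᵇ 1) l + #blocks (2 ≤ᵇ_) l                       ≡⟨ singletons+multiples l v ⟩
    blocks l                                                    ≡⟨ counted ⟨
    #blocks (_≡ᵇ 1) l + #blocks (_≡ᵇ 2) l                       ≡⟨ +-identityʳ _ ⟨
    #blocks (_≡ᵇ 1) l + #blocks (_≡ᵇ 2) l + 0                   ∎)
    where open ≡-Reasoning

module Compressed {k f : ℕ} (a : List ℕ) (valid : RGSFrom 0 a)
                  (blocks≡ : blocks a ≡ k + f) (singletons≡ : #blocks (_≡ᵇ 1) a ≡ f) where

  w cs : List ℕ
  w = compress 0 a
  cs = composition 0 a

  multiples≡ : #blocks (2 ≤ᵇ_) a ≡ k
  multiples≡ = +-cancelˡ-≡ f _ k
    (trans (cong (_+ #blocks (2 ≤ᵇ_) a) (sym singletons≡)) (trans (singletons+multiples a valid) (trans blocks≡ (+-comm k f))))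

  length-cs : length cs ≡ k
  length-cs = trans (length-composition₀ a valid) multiples≡

  w-valid : RGSFrom 0 w
  w-valid = compress-valid a valid

  w-blocks : blocks w ≡ k + f
  w-blocks = trans (blocks-compress a valid) blocks≡

  w-singletons : #blocks (_≡ᵇ 1) w ≡ f
  w-singletons = trans (#blocks-compress (_≡ᵇ 1) (_≡ᵇ 1) a valid ≡ᵇ1-⊓2) singletons≡

  w-doubletons : #blocks (_≡ᵇ 2) w ≡ k
  w-doubletons = trans (#blocks-compress (_≡ᵇ 2) (2 ≤ᵇ_) a valid ≡ᵇ2-⊓2) multiples≡

  w-length : length w ≡ 2 * k + f
  w-length = begin
    length w                                                     ≡⟨ length-≤2 w occ-w≤2 ⟩
    #blocks (_≡ᵇ 1) w + #blocks (_≡ᵇ 2) w + #blocks (_≡ᵇ 2) w   ≡⟨ cong₂ (λ s d → s + d + d) w-singletons w-doubletons ⟩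
    f + k + k                                                    ≡⟨ f+k+k≡2k+f k f ⟩
    2 * k + f                                                    ∎
    where
    open ≡-Reasoning
    occ-w≤2 : ∀ b → occ w b ≤ 2
    occ-w≤2 b = subst (_≤ 2) (sym (occ-compress₀ a valid b)) (m⊓n≤n (occ a b) 2)
    f+k+k≡2k+f : ∀ k f → f + k + k ≡ 2 * k + f
    f+k+k≡2k+f = solve-∀

  length-a : ¬ ContainsXYXX a → length a ≡ length w + sum cs
  length-a avoids = begin
    length a                 ≡⟨ cong length (expand∘compress a valid avoids (λ _ ()) (<-wellFounded (length a))) ⟨
    length (expand 0 w cs)   ≡⟨ length-expand w cs length-cs≡ ⟩
    length w + sum cs        ∎
    where
    open ≡-Reasoning
    length-cs≡ : length cs ≡ length (composition 0 w)
    length-cs≡ = trans length-cs (sym (trans (length-composition₀ w w-valid)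
                                             (trans (#blocks-compress (2 ≤ᵇ_) (2 ≤ᵇ_) a valid 2≤ᵇ-⊓2) multiples≡)))

module Expanded {k f : ℕ} (w : List ℕ) (valid : RGSFrom 0 w) (singletons≡ : #blocks (_≡ᵇ 1) w ≡ f)
                (doubletons≡ : #blocks (_≡ᵇ 2) w ≡ k) (blocks≡ : blocks w ≡ k + f)
                (cs : List ℕ) (length-cs : length cs ≡ k) where

  a : List ℕ
  a = expand 0 w cs

  matching : Matching 0 w
  matching = occ≤2 w valid (trans (cong₂ _+_ singletons≡ doubletons≡) (trans (+-comm f k) (sym blocks≡))) , λ _ ()

  length-cs≡ : length cs ≡ length (composition 0 w)
  length-cs≡ = trans length-cs (sym (trans (length-composition₀ w valid)
    (trans (#blocks-cong (2 ≤ᵇ_) (_≡ᵇ 2) w w refl (λ b → 2≤ᵇ-≤2 (proj₁ matching b))) doubletons≡)))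

  compress-a : compress 0 a ≡ w
  compress-a = proj₁ (compress∘expand w cs valid matching length-cs≡)

  composition-a : composition 0 a ≡ cs
  composition-a = proj₂ (compress∘expand w cs valid matching length-cs≡)

  a-valid : RGSFrom 0 a
  a-valid = expand-valid w cs valid

  a-avoids : ¬ ContainsXYXX a
  a-avoids = expand-avoids w cs valid matching

  a-blocks : blocks a ≡ k + f
  a-blocks = trans (sym (blocks-compress a a-valid)) (trans (cong blocks compress-a) blocks≡)

  a-singletons : #blocks (_≡ᵇ 1) a ≡ f
  a-singletons = trans (sym (#blocks-compress (_≡ᵇ 1) (_≡ᵇ 1) a a-valid ≡ᵇ1-⊓2))
                       (trans (cong (#blocks (_≡ᵇ 1)) compress-a) singletons≡)

  length-a : length a ≡ length w + sum cs
  length-a = length-expand w cs length-cs≡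

embed : ∀ {n} (l : List ℕ) → .(length l ≡ n) → Vec ℕ n
embed l eq = cast eq (fromList l)

cast-transport : ∀ (P : ∀ {n} → Vec ℕ n → Set) {m n} (eq : m ≡ n) xs → P xs → P (cast eq xs)
cast-transport P refl xs = subst P (sym (cast-is-id refl xs))

cast-transport⁻ : ∀ (P : ∀ {n} → Vec ℕ n → Set) {m n} (eq : m ≡ n) xs → P (cast eq xs) → P xs
cast-transport⁻ P refl xs = subst P (cast-is-id refl xs)

embed-transport : ∀ (P : ∀ {n} → Vec ℕ n → Set) {n} l (eq : length l ≡ n) → P (fromList l) → P (embed l eq)
embed-transport P l eq = cast-transport P eq (fromList l)

embed-transport⁻ : ∀ (P : ∀ {n} → Vec ℕ n → Set) {n} l (eq : length l ≡ n) → P (embed l eq) → P (fromList l)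
embed-transport⁻ P l eq = cast-transport⁻ P eq (fromList l)

toList-transport : ∀ (P : ∀ {n} → Vec ℕ n → Set) {n} (v : Vec ℕ n) → P v → P (fromList (toList v))
toList-transport P v = cast-transport⁻ P (length-toList v) (fromList (toList v)) ∘ subst P (sym (fromList∘toList v))

toList-transport⁻ : ∀ (P : ∀ {n} → Vec ℕ n → Set) {n} (v : Vec ℕ n) → P (fromList (toList v)) → P v
toList-transport⁻ P v = subst P (fromList∘toList v) ∘ cast-transport P (length-toList v) (fromList (toList v))

toList-embed : ∀ {n} l .(eq : length l ≡ n) → toList (embed l eq) ≡ l
toList-embed l eq = trans (toList-cast eq (fromList l)) (toList∘fromList l)

embed-≡ : ∀ {n l} (v : Vec ℕ n) .{eq : length l ≡ n} → l ≡ toList v → embed l eq ≡ v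
embed-≡ v refl = fromList∘toList v

sumV-fromList : ∀ l → sumV (fromList l) ≡ sum l
sumV-fromList [] = refl
sumV-fromList (x ∷ l) = cong (x +_) (sumV-fromList l)

ValidFrom-irrelevant : ∀ {m n} (v : Vec ℕ n) (p q : ValidFrom m v) → p ≡ q
ValidFrom-irrelevant [] _ _ = refl
ValidFrom-irrelevant (x ∷ v) (p₁ , p₂) (q₁ , q₂) = cong₂ _,_ (≤-irrelevant p₁ q₁) (ValidFrom-irrelevant v p₂ q₂)

Pi-≡ : ∀ {n k f} {π π′ : Pi n k f} → Pi.partition π ≡ Pi.partition π′ → π ≡ π′
Pi-≡ {π = mkPi _ _ _ _} {mkPi _ _ _ _} refl = refl

-- Contains ignores the validity proof; packaging one makes containment transportable.
Contains134/2 : ∀ {n} → Vec ℕ n → Set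
Contains134/2 v = Σ (IsRGS v) λ rg → Contains (v , rg) p134/2

recompute-≡ : ∀ {a b : ℕ} → .(a ≡ b) → a ≡ b
recompute-≡ = recompute (_ ≟ _)

-- The bijection

module Bijection (n k f : ℕ) (2k+f≤n : 2 * k + f ≤ n) where

  N : ℕ
  N = n ∸ f ∸ 2 * k

  N≡ : N ≡ n ∸ (2 * k + f)
  N≡ = trans (∸-+-assoc n f (2 * k)) (cong (n ∸_) (+-comm f (2 * k)))

  module FromPi {v : Vec ℕ n} (rg : IsRGS v) (avoids : Avoids (v , rg) p134/2)
                (blocks≡ : numBlocks v ≡ k + f) (singletons≡ : numSingletons v ≡ f) where
    a : List ℕ
    a = toList v

    valid : RGSFrom 0 a
    valid = toList-transport (ValidFrom 0) v rg

    open Compressed {k} {f} a valid (toList-transport (λ u → numBlocks u ≡ k + f) v blocks≡)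
      (trans (sym (numSingletons≡#blocks a)) (toList-transport (λ u → numSingletons u ≡ f) v singletons≡)) public

    a-avoids : ¬ ContainsXYXX a
    a-avoids xyxx = avoids (proj₂ (toList-transport⁻ Contains134/2 v (valid , xyxx⇒contains a valid xyxx)))

    sum-cs : sum cs ≡ N
    sum-cs = begin
      sum cs                             ≡⟨ m+n∸m≡n (2 * k + f) (sum cs) ⟨
      2 * k + f + sum cs ∸ (2 * k + f)   ≡⟨ cong (λ l → l + sum cs ∸ (2 * k + f)) w-length ⟨
      length w + sum cs ∸ (2 * k + f)    ≡⟨ cong (_∸ (2 * k + f)) (trans (sym (length-toList v)) (length-a a-avoids)) ⟨
      n ∸ (2 * k + f)                    ≡⟨ N≡ ⟨
      N                                  ∎
      where open ≡-Reasoning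

  to : Pi n k f → WeakComposition N k × M k f
  to (mkPi (v , rg) avoids blocks≡ singletons≡) =
    (embed cs length-cs , embed-transport (λ c → sumV c ≡ N) cs length-cs (trans (sumV-fromList cs) sum-cs)) ,
    (embed w w-length , embed-transport (ValidFrom 0) w w-length w-valid) ,
    embed-transport (λ u → numSingletons u ≡ f) w w-length (trans (numSingletons≡#blocks w) w-singletons) ,
    embed-transport (λ u → numDoubletons u ≡ k) w w-length (trans (numDoubletons≡#blocks w) w-doubletons) ,
    embed-transport (λ u → numBlocks u ≡ k + f) w w-length w-blocks
    where open FromPi rg (¬-recompute avoids) (recompute-≡ blocks≡) (recompute-≡ singletons≡)

  module FromM (cv : Vec ℕ k) (cv-sum : sumV cv ≡ N) (wv : Vec ℕ (2 * k + f)) (wv-valid : IsRGS wv)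
               (singletons≡ : numSingletons wv ≡ f) (doubletons≡ : numDoubletons wv ≡ k)
               (blocks≡ : numBlocks wv ≡ k + f) where
    w cs : List ℕ
    w = toList wv
    cs = toList cv

    open Expanded {k} {f} w (toList-transport (ValidFrom 0) wv wv-valid)
                  (trans (sym (numSingletons≡#blocks w)) (toList-transport (λ u → numSingletons u ≡ f) wv singletons≡))
                  (trans (sym (numDoubletons≡#blocks w)) (toList-transport (λ u → numDoubletons u ≡ k) wv doubletons≡))
                  (toList-transport (λ u → numBlocks u ≡ k + f) wv blocks≡)
                  cs (length-toList cv) public

    length-a≡n : length a ≡ n
    length-a≡n = begin
      length a                       ≡⟨ length-a ⟩
      length w + sum cs              ≡⟨ cong₂ _+_ (length-toList wv) sum-cs ⟩
      2 * k + f + N                  ≡⟨ cong (2 * k + f +_) N≡ ⟩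
      2 * k + f + (n ∸ (2 * k + f))  ≡⟨ m+[n∸m]≡n 2k+f≤n ⟩
      n                              ∎
      where
      open ≡-Reasoning
      sum-cs : sum cs ≡ N
      sum-cs = trans (sym (sumV-fromList cs)) (toList-transport (λ c → sumV c ≡ N) cv cv-sum)

    a-rgs : IsRGS (embed a length-a≡n)
    a-rgs = embed-transport (ValidFrom 0) a length-a≡n a-valid

  from : WeakComposition N k × M k f → Pi n k f
  from ((cv , cv-sum) , ((wv , wv-valid) , singletons≡ , doubletons≡ , blocks≡)) =
    mkPi (embed a length-a≡n , a-rgs)
         (λ c → let rg , c′ = embed-transport⁻ Contains134/2 a length-a≡n (a-rgs , c)
                in a-avoids (contains⇒xyxx a rg c′))
         (embed-transport (λ u → numBlocks u ≡ k + f) a length-a≡n a-blocks)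
         (embed-transport (λ u → numSingletons u ≡ f) a length-a≡n (trans (numSingletons≡#blocks a) a-singletons))
    where open FromM cv cv-sum wv wv-valid singletons≡ doubletons≡ blocks≡

  to∘from : ∀ y → to (from y) ≡ y
  to∘from ((cv , cv-sum) , ((wv , wv-valid) , singletons≡ , doubletons≡ , blocks≡)) =
    cong₂ _,_ (Σ-≡,≡→≡ (embed-≡ cv composition≡ , ≡-irrelevant _ _))
              (Σ-≡,≡→≡ (Σ-≡,≡→≡ (embed-≡ wv compress≡ , ValidFrom-irrelevant wv _ _) , counts-irrelevant _ _))
    where
    open FromM cv cv-sum wv wv-valid singletons≡ doubletons≡ blocks≡
    composition≡ : composition 0 (toList (embed a length-a≡n)) ≡ cs
    composition≡ = trans (cong (composition 0) (toList-embed a length-a≡n)) composition-a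
    compress≡ : compress 0 (toList (embed a length-a≡n)) ≡ w
    compress≡ = trans (cong (compress 0) (toList-embed a length-a≡n)) compress-a
    counts-irrelevant : ∀ {a b c d e g : ℕ} (p q : (a ≡ b) × (c ≡ d) × (e ≡ g)) → p ≡ q
    counts-irrelevant (p₁ , p₂ , p₃) (q₁ , q₂ , q₃) =
      cong₂ _,_ (≡-irrelevant p₁ q₁) (cong₂ _,_ (≡-irrelevant p₂ q₂) (≡-irrelevant p₃ q₃))

  from∘to : ∀ π → from (to π) ≡ π
  from∘to (mkPi (v , rg) avoids blocks≡ singletons≡) =
    Pi-≡ (Σ-≡,≡→≡ (embed-≡ v expand≡ , ValidFrom-irrelevant v _ _))
    where
    open FromPi rg (¬-recompute avoids) (recompute-≡ blocks≡) (recompute-≡ singletons≡)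
    expand≡ : expand 0 (toList (embed w w-length)) (toList (embed cs length-cs)) ≡ toList v
    expand≡ = trans (cong₂ (expand 0) (toList-embed w w-length) (toList-embed cs length-cs))
                    (expand∘compress a valid a-avoids (λ _ ()) (<-wellFounded (length a)))

lemma4p12 : (n k f : ℕ) → k ≥ 1 → 2 * k + f ≤ n →
    Pi n k f ↔ (WeakComposition (n ∸ f ∸ 2 * k) k × M k f)
lemma4p12 n k f _ 2k+f≤n = mk↔ₛ′ to from to∘from from∘to
  where open Bijection n k f 2k+f≤n
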